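{- Let $X$ be a simplicial complex on a finite vertex set $V$. For each $v\in V$ let $k_v \ge 1$ be an integer, let $\tilde{V} = \{(v,i):\, v \in V,\ i = 1,\ldots,k_v\}$, and let $\tilde{X}$ be the simplicial complex on $\tilde{V}$ whose faces are those subsets of $\tilde{V}$ whose projection $\{v : (v,i)\in \cdot\}$ onto $V$ is a face of $X$. Let $d$ be a positive integer. If $X$ is $d$-collapsible, then $\tilde{X}$ is $d$-collapsible.
   Context: A simplicial complex on a finite set $V$ is a family of subsets of $V$ (faces) closed under taking subsets; a facet is an inclusion-maximal face. For a positive integer $d$: if $\sigma$ is a face of $X$ contained in a unique facet of $X$ and $|\sigma| \le d$, the operation of removing from $X$ the face $\sigma$ and all faces containing it is an elementary $d$-collapse. $X$ is $d$-collapsible if there is a finite sequence of elementary $d$-collapses reducing $X$ to $\{\emptyset\}$. -}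

module Defs where

open import Data.Nat using (ℕ; zero; suc; _+_; _≤_)
open import Data.Fin using (Fin; zero; suc; splitAt)
open import Data.Fin.Subset using (Subset; _⊆_; ⊥; ∣_∣; _∈_)
open import Data.Bool using (Bool; true; false)
open import Data.Sum using (inj₁; inj₂)
open import Data.Product using (Σ; ∃; _×_; _,_)
open import Relation.Nullary using (¬_)
open import Relation.Binary.PropositionalEquality using (_≡_)
open import Relation.Binary.Construct.Closure.ReflexiveTransitive using (Star)
open import Function.Bundles using (_⇔_)

Family : ℕ → Set
Family n = Subset n → Bool

_∈F_ : ∀ {n} → Subset n → Family n → Set
σ ∈F X = X σ ≡ true

IsComplex : ∀ {n} → Family n → Set
IsComplex {n} X = ∀ (σ τ : Subset n) → σ ⊆ τ → τ ∈F X → σ ∈F X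

IsFacet : ∀ {n} → Family n → Subset n → Set
IsFacet {n} X F = F ∈F X × (∀ (G : Subset n) → G ∈F X → F ⊆ G → G ≡ F)

UniqueFacet : ∀ {n} → Family n → Subset n → Set
UniqueFacet {n} X σ =
  Σ (Subset n) λ F → IsFacet X F × σ ⊆ F ×
    (∀ (G : Subset n) → IsFacet X G → σ ⊆ G → G ≡ F)

ElemCollapse : ∀ {n} → ℕ → Family n → Family n → Set
ElemCollapse {n} d X Y =
  Σ (Subset n) λ σ → σ ∈F X × UniqueFacet X σ × ∣ σ ∣ ≤ d ×
    (∀ (τ : Subset n) → (τ ∈F Y) ⇔ (τ ∈F X × ¬ (σ ⊆ τ)))

Collapsible : ∀ {n} → ℕ → Family n → Set
Collapsible {n} d X =
  Σ (Family n) λ Y → Star (ElemCollapse d) X Y ×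
    (∀ (τ : Subset n) → (τ ∈F Y) ⇔ (τ ≡ ⊥))

-- Blow-up vertex set  Ṽ = {(v,i) : v ∈ V, i < k v},
-- encoded as Fin (total k), blocks listed in order of v.
total : ∀ {n} → (Fin n → ℕ) → ℕ
total {zero} k = 0
total {suc n} k = k zero + total (λ v → k (suc v))

proj : ∀ {n} (k : Fin n → ℕ) → Fin (total k) → Fin n
proj {suc n} k j with splitAt (k zero) j
... | inj₁ _ = zero
... | inj₂ j' = suc (proj (λ v → k (suc v)) j')

IsProjection : ∀ {n} (k : Fin n → ℕ) → Subset (total k) → Subset n → Set
IsProjection {n} k S P =
  ∀ (v : Fin n) → v ∈ P ⇔ (∃ λ j → j ∈ S × proj k j ≡ v)

IsBlowUp : ∀ {n} (k : Fin n → ℕ) → Family n → Family (total k) → Set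
IsBlowUp {n} k X X̃ =
  ∀ (S : Subset (total k)) →
    (S ∈F X̃) ⇔ (∃ λ P → IsProjection k S P × P ∈F X)

-- We prove it for the pullback K = { T ⊆ Ṽ | p(T) ∈ X } along ANY map p : Ṽ → V,
-- lifting the collapses of X one at a time.  Collapsing σ in X (unique facet F,
-- |σ| ≤ d) deletes the faces containing σ; upstairs the faces T with σ ⊆ p(T)
-- must go, and all of them lie in M = p⁻¹(F).  Say T covers σ through U ⊆ p⁻¹(σ)
-- if every vertex of σ has a preimage in T ∩ U.  By well-founded induction on U,
-- the covers through U are removed by d-collapses:
--   * p injective on U, p(U) ⊇ σ: covering through U means containing U, and U
--     (size ≤ |σ| ≤ d, unique facet M) is collapsed in one step;
--   * p injective on U, p(U) ⊉ σ: there is nothing to remove;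
--   * b ≠ b' in U with p b = p b': a cover containing b covers through U minus
--     the rest of b's fibre, one avoiding b covers through U − b; remove these
--     two kinds in turn, the second within M − b.
-- Taking U = p⁻¹(σ) lifts one collapse, and induction lifts the whole sequence.
module Submission where

open import Defs
open import Data.Nat using (ℕ; _≤_; z≤n; s≤s)
open import Data.Nat.Properties using (≤-trans)
open import Data.Bool using (true; false) renaming (_≟_ to _≟ᵇ_)
open import Data.Fin using (Fin; zero; suc)
open import Data.Fin.Properties using (any?; suc-injective; 0≢1+n) renaming (_≟_ to _≟ᶠ_)
open import Data.Fin.Subset using (Subset; _⊆_; _⊂_; _⊃_; _∪_; ⁅_⁆; ⊥; ∣_∣; _∈_; _∉_; _-_)
open import Data.Fin.Subset.Properties
  using (_∈?_; _⊆?_; ⊆-antisym; ⊆-trans; ∉⊥; Empty-unique; x∈⁅x⁆; x∈⁅y⁆⇒x≡y; p⊆p∪q; x∈p∪q⁺; x∈p∪q⁻;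
         x∈p∧x≢y⇒x∈p-y; x∈p⇒∣p-x∣<∣p∣)
open import Data.Fin.Subset.Induction using (Acc; acc; ⊂-wellFounded; ⊃-wellFounded)
open import Data.Vec using ([]; _∷_; here; there; tabulate)
open import Data.Vec.Properties using (lookup∘tabulate; []=⇒lookup; lookup⇒[]=)
open import Data.Product using (Σ; ∃; _×_; _,_)
open import Data.Sum using (_⊎_; inj₁; inj₂; [_,_])
open import Function using (_∘_; id)
open import Function.Bundles using (_⇔_; mk⇔; Equivalence)
open import Relation.Nullary using (¬_; Dec; yes; no; does)
open import Relation.Nullary.Decidable using (_×-dec_; _⊎-dec_; ¬?; dec-true; decidable-stable)
open import Relation.Unary using (Decidable)
open import Relation.Binary.PropositionalEquality using (_≡_; _≢_; refl; sym; trans; subst)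
open import Relation.Binary.Construct.Closure.ReflexiveTransitive using (Star; ε; _◅_; _◅◅_)

open Equivalence using (to; from)

private
  variable
    m n : ℕ
    X Y K Z : Family n
    Q Q′ : Subset n → Set

does-true⇒ : ∀ {A : Set} (a? : Dec A) → does a? ≡ true → A
does-true⇒ (yes a) _ = a

select : {P : Fin n → Set} → Decidable P → Subset n
select P? = tabulate (λ x → does (P? x))

∈-select : {P : Fin n → Set} (P? : Decidable P) {x : Fin n} → x ∈ select P? ⇔ P x
∈-select P? {x} = mk⇔
  (λ x∈ → does-true⇒ (P? x) (trans (sym (lookup∘tabulate _ x)) ([]=⇒lookup x∈)))
  (λ Px → lookup⇒[]= x _ (trans (lookup∘tabulate _ x) (dec-true (P? x) Px)))

without : Subset n → Fin n → Subset n
without U b = select (λ x → (x ∈? U) ×-dec ¬? (x ≟ᶠ b))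

∈-without : ∀ {U : Subset n} {b x} → x ∈ without U b ⇔ (x ∈ U × x ≢ b)
∈-without {U = U} {b} = ∈-select (λ x → (x ∈? U) ×-dec ¬? (x ≟ᶠ b))

without⊆ : ∀ {U : Subset n} {b} → without U b ⊆ U
without⊆ x∈ = let (x∈U , _) = to ∈-without x∈ in x∈U

b∉without : ∀ {U : Subset n} {b} → b ∉ without U b
b∉without b∈ = let (_ , b≢b) = to ∈-without b∈ in b≢b refl

InjectiveOn : (Fin m → Fin n) → Subset m → Set
InjectiveOn f U = ∀ {i j} → i ∈ U → j ∈ U → f i ≡ f j → i ≡ j

∣∣≤-injection : (f : Fin m → Fin n) (U : Subset m) {σ : Subset n} →
  (∀ {j} → j ∈ U → f j ∈ σ) → InjectiveOn f U → ∣ U ∣ ≤ ∣ σ ∣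
∣∣≤-injection f [] _ _ = z≤n
∣∣≤-injection f (false ∷ U) f∈σ inj =
  ∣∣≤-injection (f ∘ suc) U (f∈σ ∘ there) (λ i j e → suc-injective (inj (there i) (there j) e))
∣∣≤-injection f (true ∷ U) {σ} f∈σ inj =
  ≤-trans (s≤s (∣∣≤-injection (f ∘ suc) U f∈σ-f₀ inj-suc)) (x∈p⇒∣p-x∣<∣p∣ (f∈σ here))
  where
  f∈σ-f₀ : ∀ {j} → j ∈ U → f (suc j) ∈ σ - f zero
  f∈σ-f₀ j∈U = x∈p∧x≢y⇒x∈p-y (f∈σ (there j∈U)) (λ e → 0≢1+n (inj here (there j∈U) (sym e)))
  inj-suc : InjectiveOn (f ∘ suc) U
  inj-suc i j e = suc-injective (inj (there i) (there j) e)

-- Every face of a complex lies in a facet: enlarge it by one vertex while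
-- possible (well-founded recursion on ⊃).
facet-above : IsComplex X → (R : Subset n) → Acc _⊃_ R → R ∈F X →
  Σ (Subset n) λ G → IsFacet X G × R ⊆ G
facet-above {X = X} cX R (acc larger) R∈X
  with any? (λ j → ¬? (j ∈? R) ×-dec (X (R ∪ ⁅ j ⁆) ≟ᵇ true))
... | yes (j , j∉R , R+j∈X) =
  let (G , G-facet , R+j⊆G) = facet-above cX (R ∪ ⁅ j ⁆) (larger R⊂R+j) R+j∈X
  in G , G-facet , R+j⊆G ∘ p⊆p∪q ⁅ j ⁆
  where
  R⊂R+j : R ⊂ R ∪ ⁅ j ⁆
  R⊂R+j = p⊆p∪q ⁅ j ⁆ , j , x∈p∪q⁺ (inj₂ (x∈⁅x⁆ j)) , j∉R
... | no unextendable = R , (R∈X , λ G G∈X R⊆G → ⊆-antisym (G⊆R G∈X R⊆G) R⊆G) , id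
  where
  G⊆R : ∀ {G} → G ∈F X → R ⊆ G → G ⊆ R
  G⊆R {G} G∈X R⊆G {x} x∈G = decidable-stable (x ∈? R) λ x∉R →
    unextendable (x , x∉R , cX (R ∪ ⁅ x ⁆) G R+x⊆G G∈X)
    where
    R+x⊆G : R ∪ ⁅ x ⁆ ⊆ G
    R+x⊆G y∈ with x∈p∪q⁻ R ⁅ x ⁆ y∈
    ... | inj₁ y∈R = R⊆G y∈R
    ... | inj₂ y∈x = subst (_∈ G) (sym (x∈⁅y⁆⇒x≡y x y∈x)) x∈G

uniqueFacet-bound : {σ M : Subset n} → M ∈F K → σ ⊆ M →
  (∀ T → T ∈F K → σ ⊆ T → T ⊆ M) → UniqueFacet K σ
uniqueFacet-bound {K = K} {σ} {M} M∈K σ⊆M bound =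
  M , M-facet , σ⊆M , λ G (G∈K , G-maximal) σ⊆G → sym (G-maximal M M∈K (bound G G∈K σ⊆G))
  where
  M-facet : IsFacet K M
  M-facet = M∈K , λ G G∈K M⊆G → ⊆-antisym (bound G G∈K (M⊆G ∘ σ⊆M)) M⊆G

Deletion : Family n → (Subset n → Set) → Family n → Set
Deletion K Q Z = ∀ T → (T ∈F Z) ⇔ (T ∈F K × ¬ Q T)

deletion-exists : (K : Family n) → Decidable Q → Σ (Family n) (Deletion K Q)
deletion-exists {Q = Q} K Q? =
  (λ T → does (decide T)) , λ T → mk⇔ (does-true⇒ (decide T)) (dec-true (decide T))
  where
  decide : ∀ T → Dec (T ∈F K × ¬ Q T)
  decide T = (K T ≟ᵇ true) ×-dec ¬? (Q? T)

deletion-isComplex : IsComplex K → (∀ {S T} → S ⊆ T → Q S → Q T) →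
  Deletion K Q Z → IsComplex Z
deletion-isComplex cK Q-up Z≅ S T S⊆T T∈Z =
  let (T∈K , ¬QT) = to (Z≅ T) T∈Z
  in from (Z≅ S) (cK S T S⊆T T∈K , ¬QT ∘ Q-up S⊆T)

deletion-none : (K : Family n) → (∀ T → ¬ Q T) → Deletion K Q K
deletion-none K ¬Q T = mk⇔ (λ T∈K → T∈K , ¬Q T) (λ (T∈K , _) → T∈K)

deletion-cong : (∀ T → Q T ⇔ Q′ T) → Deletion K Q Z → Deletion K Q′ Z
deletion-cong Q⇔Q′ Z≅ T = mk⇔
  (λ T∈Z → let (T∈K , ¬QT) = to (Z≅ T) T∈Z in T∈K , ¬QT ∘ from (Q⇔Q′ T))
  (λ (T∈K , ¬Q′T) → from (Z≅ T) (T∈K , ¬Q′T ∘ to (Q⇔Q′ T)))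

deletion-∘ : {K₁ : Family n} {Q₁ Q₂ : Subset n → Set} → (∀ T → Q T ⇔ (Q₁ T ⊎ Q₂ T)) →
  Deletion K Q₁ K₁ → Deletion K₁ Q₂ Z → Deletion K Q Z
deletion-∘ Q⇔ K₁≅ Z≅ T = mk⇔
  (λ T∈Z → let (T∈K₁ , ¬Q₂T) = to (Z≅ T) T∈Z ; (T∈K , ¬Q₁T) = to (K₁≅ T) T∈K₁
           in T∈K , [ ¬Q₁T , ¬Q₂T ] ∘ to (Q⇔ T))
  (λ (T∈K , ¬QT) → from (Z≅ T) ( from (K₁≅ T) (T∈K , ¬QT ∘ from (Q⇔ T) ∘ inj₁)
                               , ¬QT ∘ from (Q⇔ T) ∘ inj₂))

elemCollapse-isComplex : {d : ℕ} → IsComplex X → ElemCollapse d X Y → IsComplex Y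
elemCollapse-isComplex cX (σ , _ , _ , _ , Y≅) =
  deletion-isComplex {Q = σ ⊆_} cX (λ S⊆T σ⊆S → ⊆-trans σ⊆S S⊆T) Y≅

CollapsesAway : ℕ → Family n → (Subset n → Set) → Set
CollapsesAway {n} d K Q = Σ (Family n) λ Z → Star (ElemCollapse d) K Z × Deletion K Q Z

module Pullback (p : Fin m → Fin n) where

  image : Subset m → Subset n
  image T = select (λ v → any? (λ j → (j ∈? T) ×-dec (p j ≟ᶠ v)))

  ∈-image : ∀ {T v} → v ∈ image T ⇔ (∃ λ j → j ∈ T × p j ≡ v)
  ∈-image {T} = ∈-select (λ v → any? (λ j → (j ∈? T) ×-dec (p j ≟ᶠ v)))

  ∈-image⁺ : ∀ {T j} → j ∈ T → p j ∈ image T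
  ∈-image⁺ j∈T = from ∈-image (_ , j∈T , refl)

  image-mono : ∀ {S T} → S ⊆ T → image S ⊆ image T
  image-mono S⊆T v∈ = let (j , j∈S , pj≡v) = to ∈-image v∈ in from ∈-image (j , S⊆T j∈S , pj≡v)

  image≡⊥⇔ : ∀ {T} → image T ≡ ⊥ ⇔ T ≡ ⊥
  image≡⊥⇔ {T} = mk⇔
    (λ iT≡⊥ → Empty-unique λ (j , j∈T) → ∉⊥ (subst (p j ∈_) iT≡⊥ (∈-image⁺ j∈T)))
    (λ T≡⊥ → Empty-unique λ (v , v∈) →
      let (j , j∈T , _) = to ∈-image v∈ in ∉⊥ (subst (j ∈_) T≡⊥ j∈T))

  image-unique : ∀ {T P} → (∀ v → v ∈ P ⇔ (∃ λ j → j ∈ T × p j ≡ v)) → P ≡ image T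
  image-unique P≅ = ⊆-antisym (λ {v} v∈P → from ∈-image (to (P≅ v) v∈P))
                              (λ {v} v∈ → from (P≅ v) (to ∈-image v∈))

  preimage : Subset n → Subset m
  preimage F = select (λ j → p j ∈? F)

  ∈-preimage : ∀ {F j} → j ∈ preimage F ⇔ p j ∈ F
  ∈-preimage {F} = ∈-select (λ j → p j ∈? F)

  image-preimage : ∀ {F} → image (preimage F) ⊆ F
  image-preimage v∈ = let (j , j∈ , pj≡v) = to ∈-image v∈ in subst (_∈ _) pj≡v (to ∈-preimage j∈)

  IsPullback : Family n → Family m → Set
  IsPullback X K = ∀ T → (T ∈F K) ⇔ (image T ∈F X)

  pullback-isComplex : IsComplex X → IsPullback X K → IsComplex K
  pullback-isComplex cX K≅ S T S⊆T T∈K =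
    from (K≅ S) (cX (image S) (image T) (image-mono S⊆T) (to (K≅ T) T∈K))

  pullback-void : (∀ τ → (τ ∈F Y) ⇔ (τ ≡ ⊥)) → IsPullback Y Z → ∀ T → (T ∈F Z) ⇔ (T ≡ ⊥)
  pullback-void Y≅ Z≅ T = mk⇔ (to image≡⊥⇔ ∘ to (Y≅ (image T)) ∘ to (Z≅ T))
                              (from (Z≅ T) ∘ from (Y≅ (image T)) ∘ from image≡⊥⇔)

  pullback-deletion : {σ : Subset n} → IsPullback X K → Deletion X (σ ⊆_) Y →
    Deletion K (λ T → σ ⊆ image T) Z → IsPullback Y Z
  pullback-deletion K≅ Y≅ Z≅ T = mk⇔
    (λ T∈Z → let (T∈K , ¬cov) = to (Z≅ T) T∈Z in from (Y≅ (image T)) (to (K≅ T) T∈K , ¬cov))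
    (λ iT∈Y → let (iT∈X , ¬cov) = to (Y≅ (image T)) iT∈Y in from (Z≅ T) (from (K≅ T) iT∈X , ¬cov))

  module RemoveCovers (d : ℕ) (σ : Subset n) (σ≤d : ∣ σ ∣ ≤ d) where

    Covers : Subset m → Subset m → Set
    Covers U T = ∀ v → v ∈ σ → ∃ λ j → j ∈ T × j ∈ U × p j ≡ v

    covers-mono : ∀ {U U′ S T} → S ⊆ T → U ⊆ U′ → Covers U S → Covers U′ T
    covers-mono S⊆T U⊆U′ cov v v∈σ =
      let (j , j∈S , j∈U , pj≡v) = cov v v∈σ in j , S⊆T j∈S , U⊆U′ j∈U , pj≡v

    Clearable : Subset m → Set
    Clearable U = ∀ K → IsComplex K → ∀ M → M ∈F K → U ⊆ M →
      (∀ T → T ∈F K → Covers U T → T ⊆ M) → CollapsesAway d K (Covers U)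

    -- Injective case: covering through U means containing U, which is
    -- collapsed in one step (or no face covers at all).
    clearable-injective : ∀ {U} → U ⊆ preimage σ → InjectiveOn p U → Clearable U
    clearable-injective {U} U⊆σ inj K cK M M∈K U⊆M bound with σ ⊆? image U
    ... | no σ⊈pU = K , ε , deletion-none {Q = Covers U} K λ T cov →
          σ⊈pU λ {v} v∈σ → let (j , _ , j∈U , pj≡v) = cov v v∈σ in subst (_∈ _) pj≡v (∈-image⁺ j∈U)
    ... | yes σ⊆pU =
          let (Z , Z≅) = deletion-exists K (U ⊆?_)
          in Z , (U , U∈K , uniqueFacet-bound M∈K U⊆M bound′ , ∣U∣≤d , Z≅) ◅ ε ,
             deletion-cong contains⇔covers Z≅
      where
      contains⇔covers : ∀ T → U ⊆ T ⇔ Covers U T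
      contains⇔covers T = mk⇔ contains⇒covers covers⇒contains
        where
        contains⇒covers : U ⊆ T → Covers U T
        contains⇒covers U⊆T v v∈σ =
          let (j , j∈U , pj≡v) = to ∈-image (σ⊆pU v∈σ) in j , U⊆T j∈U , j∈U , pj≡v
        covers⇒contains : Covers U T → U ⊆ T
        covers⇒contains cov {j} j∈U =
          let (i , i∈T , i∈U , pi≡pj) = cov (p j) (to ∈-preimage (U⊆σ j∈U))
          in subst (_∈ T) (inj i∈U j∈U pi≡pj) i∈T
      bound′ : ∀ T → T ∈F K → U ⊆ T → T ⊆ M
      bound′ T T∈K U⊆T = bound T T∈K (to (contains⇔covers T) U⊆T)
      U∈K : U ∈F K
      U∈K = cK U M U⊆M M∈K
      ∣U∣≤d : ∣ U ∣ ≤ d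
      ∣U∣≤d = ≤-trans (∣∣≤-injection p U (to ∈-preimage ∘ U⊆σ) inj) σ≤d

    pruneFibre : Subset m → Fin m → Subset m
    pruneFibre U b = select (λ x → (x ∈? U) ×-dec ((x ≟ᶠ b) ⊎-dec ¬? (p x ≟ᶠ p b)))

    ∈-pruneFibre : ∀ {U b x} → x ∈ pruneFibre U b ⇔ (x ∈ U × (x ≡ b ⊎ p x ≢ p b))
    ∈-pruneFibre {U} {b} = ∈-select (λ x → (x ∈? U) ×-dec ((x ≟ᶠ b) ⊎-dec ¬? (p x ≟ᶠ p b)))

    pruneFibre⊆ : ∀ {U b} → pruneFibre U b ⊆ U
    pruneFibre⊆ x∈ = let (x∈U , _) = to ∈-pruneFibre x∈ in x∈U

    -- A cover containing b can use b for the vertex p b.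
    prune-covers : ∀ {U T b} → b ∈ U → b ∈ T → Covers U T → Covers (pruneFibre U b) T
    prune-covers {b = b} b∈U b∈T cov v v∈σ with cov v v∈σ
    ... | j , j∈T , j∈U , pj≡v with p j ≟ᶠ p b
    ...   | yes pj≡pb = b , b∈T , from ∈-pruneFibre (b∈U , inj₁ refl) , trans (sym pj≡pb) pj≡v
    ...   | no pj≢pb = j , j∈T , from ∈-pruneFibre (j∈U , inj₂ pj≢pb) , pj≡v

    prune-uncovers : ∀ {U T b} → p b ∈ σ → b ∉ T → ¬ Covers (pruneFibre U b) T
    prune-uncovers {T = T} pb∈σ b∉T cov with cov _ pb∈σ
    ... | j , j∈T , j∈U′ , pj≡pb with to ∈-pruneFibre j∈U′
    ...   | _ , inj₁ j≡b = b∉T (subst (_∈ T) j≡b j∈T)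
    ...   | _ , inj₂ pj≢pb = pj≢pb pj≡pb

    without-covers : ∀ {U T b} → b ∉ T → Covers U T → Covers (without U b) T
    without-covers {T = T} b∉T cov v v∈σ =
      let (j , j∈T , j∈U , pj≡v) = cov v v∈σ
      in j , j∈T , from ∈-without (j∈U , λ j≡b → b∉T (subst (_∈ T) j≡b j∈T)) , pj≡v

    -- Splitting step: remove first the covers through pruneFibre U b, then,
    -- inside M − b, those through U − b.
    clearable-split : ∀ {U b} → b ∈ U → U ⊆ preimage σ →
      Clearable (pruneFibre U b) → Clearable (without U b) → Clearable U
    clearable-split {U} {b} b∈U U⊆σ clear₁ clear₂ K cK M M∈K U⊆M bound =
      let (K₁ , K↠K₁ , K₁≅) = clear₁ K cK M M∈K (U⊆M ∘ pruneFibre⊆) bound₁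
          (Z , K₁↠Z , Z≅) = clear₂ K₁ (deletion-isComplex cK (λ S⊆T → covers-mono S⊆T id) K₁≅)
                                   (without M b) (M-b∈K₁ K₁≅) U₂⊆M-b (bound₂ K₁≅)
      in Z , K↠K₁ ◅◅ K₁↠Z , deletion-∘ split K₁≅ Z≅
      where
      bound₁ : ∀ T → T ∈F K → Covers (pruneFibre U b) T → T ⊆ M
      bound₁ T T∈K = bound T T∈K ∘ covers-mono id pruneFibre⊆
      pb∈σ : p b ∈ σ
      pb∈σ = to ∈-preimage (U⊆σ b∈U)
      U₂⊆M-b : without U b ⊆ without M b
      U₂⊆M-b x∈ = let (x∈U , x≢b) = to ∈-without x∈ in from ∈-without (U⊆M x∈U , x≢b)
      split : ∀ T → Covers U T ⇔ (Covers (pruneFibre U b) T ⊎ Covers (without U b) T)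
      split T = mk⇔ split⇒ [ covers-mono id pruneFibre⊆ , covers-mono id without⊆ ]
        where
        split⇒ : Covers U T → Covers (pruneFibre U b) T ⊎ Covers (without U b) T
        split⇒ cov with b ∈? T
        ... | yes b∈T = inj₁ (prune-covers b∈U b∈T cov)
        ... | no b∉T = inj₂ (without-covers b∉T cov)
      module _ {K₁ : Family m} (K₁≅ : Deletion K (Covers (pruneFibre U b)) K₁) where
        M-b∈K₁ : without M b ∈F K₁
        M-b∈K₁ = from (K₁≅ _) (cK _ M without⊆ M∈K , prune-uncovers pb∈σ b∉without)
        bound₂ : ∀ T → T ∈F K₁ → Covers (without U b) T → T ⊆ without M b
        bound₂ T T∈K₁ cov₂ {x} x∈T =
          let (T∈K , ¬cov₁) = to (K₁≅ T) T∈K₁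
              cov = covers-mono id without⊆ cov₂
          in from ∈-without
               (bound T T∈K cov x∈T , λ x≡b → ¬cov₁ (prune-covers b∈U (subst (_∈ T) x≡b x∈T) cov))

    -- Every U ⊆ p⁻¹(σ) is clearable: split along collisions of p, by
    -- well-founded induction on ⊂.
    clearable : ∀ U → Acc _⊂_ U → U ⊆ preimage σ → Clearable U
    clearable U (acc smaller) U⊆σ
      with any? (λ b → any? (λ b′ →
             (b ∈? U) ×-dec (b′ ∈? U) ×-dec ¬? (b ≟ᶠ b′) ×-dec (p b ≟ᶠ p b′)))
    ... | yes (b , b′ , b∈U , b′∈U , b≢b′ , pb≡pb′) =
          clearable-split b∈U U⊆σ
            (clearable _ (smaller (pruneFibre⊆ , b′ , b′∈U , b′∉pruneFibre)) (U⊆σ ∘ pruneFibre⊆))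
            (clearable _ (smaller (without⊆ , b , b∈U , b∉without)) (U⊆σ ∘ without⊆))
      where
      b′∉pruneFibre : b′ ∉ pruneFibre U b
      b′∉pruneFibre b′∈ with to ∈-pruneFibre b′∈
      ... | _ , inj₁ b′≡b = b≢b′ (sym b′≡b)
      ... | _ , inj₂ pb′≢pb = pb′≢pb (sym pb≡pb′)
    ... | no no-collision = clearable-injective U⊆σ λ {i} {j} i∈U j∈U pi≡pj →
          decidable-stable (i ≟ᶠ j) λ i≢j → no-collision (i , j , i∈U , j∈U , i≢j , pi≡pj)

  collapse-lifts : {d : ℕ} → IsComplex X → IsPullback X K → ElemCollapse d X Y →
    Σ (Family m) λ Z → Star (ElemCollapse d) K Z × IsPullback Y Z
  collapse-lifts {K = K} {d = d} cX K≅ (σ , _ , (F , (F∈X , _) , σ⊆F , F-unique) , σ≤d , Y≅) =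
    let (Z , K↠Z , Z≅) = clearable (preimage σ) (⊂-wellFounded _) id K cK (preimage F) M∈K
                           (λ j∈ → from ∈-preimage (σ⊆F (to ∈-preimage j∈))) bound
    in Z , K↠Z , pullback-deletion K≅ Y≅ (deletion-cong covers⇔ Z≅)
    where
    open RemoveCovers d σ σ≤d
    cK : IsComplex K
    cK = pullback-isComplex cX K≅
    M∈K : preimage F ∈F K
    M∈K = from (K≅ _) (cX _ F image-preimage F∈X)
    covers⇔ : ∀ T → Covers (preimage σ) T ⇔ (σ ⊆ image T)
    covers⇔ T = mk⇔ covers⇒ ⇒covers
      where
      covers⇒ : Covers (preimage σ) T → σ ⊆ image T
      covers⇒ cov {v} v∈σ = let (j , j∈T , _ , pj≡v) = cov v v∈σ in subst (_∈ _) pj≡v (∈-image⁺ j∈T)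
      ⇒covers : σ ⊆ image T → Covers (preimage σ) T
      ⇒covers σ⊆pT v v∈σ = let (j , j∈T , pj≡v) = to ∈-image (σ⊆pT v∈σ)
                           in j , j∈T , from ∈-preimage (subst (_∈ σ) (sym pj≡v) v∈σ) , pj≡v
    -- a face whose image contains σ lies in F: its image lies in a facet, which is F
    bound : ∀ T → T ∈F K → Covers (preimage σ) T → T ⊆ preimage F
    bound T T∈K cov j∈T =
      let (G , G-facet , pT⊆G) = facet-above cX (image T) (⊃-wellFounded _) (to (K≅ T) T∈K)
          G≡F = F-unique G G-facet (pT⊆G ∘ to (covers⇔ T) cov)
      in from ∈-preimage (subst (_ ∈_) G≡F (pT⊆G (∈-image⁺ j∈T)))

  collapses-lift : {d : ℕ} → IsComplex X → IsPullback X K → Star (ElemCollapse d) X Y →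
    Σ (Family m) λ Z → Star (ElemCollapse d) K Z × IsPullback Y Z
  collapses-lift {K = K} cX K≅ ε = K , ε , K≅
  collapses-lift cX K≅ (step ◅ rest) =
    let (K₁ , K↠K₁ , K₁≅) = collapse-lifts cX K≅ step
        (Z , K₁↠Z , Z≅) = collapses-lift (elemCollapse-isComplex cX step) K₁≅ rest
    in Z , K↠K₁ ◅◅ K₁↠Z , Z≅

blowUp-isPullback : (k : Fin n → ℕ) {X̃ : Family (total k)} →
  IsBlowUp k X X̃ → Pullback.IsPullback (proj k) X X̃
blowUp-isPullback {X = X} k blowUp S = mk⇔
  (λ S∈X̃ → let (P , P-proj , P∈X) = to (blowUp S) S∈X̃ in subst (_∈F X) (image-unique P-proj) P∈X)
  (λ pS∈X → from (blowUp S) (image S , (λ v → ∈-image) , pS∈X))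
  where open Pullback (proj k)

proposition9 : ∀ (n : ℕ) (X : Family n) (k : Fin n → ℕ) (X̃ : Family (total k)) (d : ℕ) →
    IsComplex X → (∀ (v : Fin n) → 1 ≤ k v) → IsBlowUp k X X̃ → 1 ≤ d →
    Collapsible d X → Collapsible d X̃
proposition9 n X k X̃ d cX _ blowUp _ (Y , X↠Y , Y-void) =
  let (Z , X̃↠Z , Z≅Y) = collapses-lift cX (blowUp-isPullback k blowUp) X↠Y
  in Z , X̃↠Z , pullback-void Y-void Z≅Y
  where open Pullback (proj k)
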